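{- Let $F$ be a CNF formula, $c_1, c_2$ clauses and $x$ a variable such that $c_1 \vee c_2 \in F$, $c_1 \notin F$, and $x$ does not occur in $F$. If $c_1 \vee x$ is superredundant in $(F \setminus \{c_1 \vee c_2\}) \cup \{c_1 \vee x,\ c_2 \vee \neg x\}$, then $c_1$ is superredundant in $F \cup \{c_1\}$.
   Context: A CNF formula is a finite set of clauses; a clause is a finite set of literals, read as their disjunction. Tautological clauses are not allowed. Resolution: from clauses $c_1 \vee l$ and $c_2 \vee \neg l$ derive $c_1 \vee c_2$; two clauses whose resolvent would be a tautology are considered not to resolve. The resolution closure $\mathrm{ResCn}(F)$ is the set of all clauses obtainable from $F$ by zero or more resolution steps. A clause $c \in F$ is superredundant in $F$ if $\mathrm{ResCn}(F) \setminus \{c\} \models c$. -}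

module Defs where

open import Data.Nat using (ℕ)
import Data.Nat as ℕ
open import Data.Bool using (Bool; true; false; not)
open import Data.List using (List; []; _∷_; _++_; filter)
open import Data.List.Membership.Propositional using (_∈_; _∉_)
open import Data.List.Relation.Unary.Any using (Any)
open import Data.List.Relation.Unary.All using (All)
open import Data.Product using (_×_; Σ; ∃; ∃-syntax; _,_)
open import Data.Sum using (_⊎_)
open import Relation.Nullary using (¬_; Dec; yes; no; ¬?)
open import Relation.Binary.PropositionalEquality using (_≡_; refl; cong)

data Lit : Set where
  pos : ℕ → Lit
  neg : ℕ → Lit

~_ : Lit → Lit
~ pos x = neg x
~ neg x = pos x

_≟L_ : (l m : Lit) → Dec (l ≡ m)
pos x ≟L pos y with x ℕ.≟ y
... | yes refl = yes refl
... | no x≢y = no λ { refl → x≢y refl }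
pos x ≟L neg y = no λ ()
neg x ≟L pos y = no λ ()
neg x ≟L neg y with x ℕ.≟ y
... | yes refl = yes refl
... | no x≢y = no λ { refl → x≢y refl }

-- A clause is a finite set of literals, represented by a list read as a set
-- (order and repetitions irrelevant).  Disjunction c₁ ∨ c₂ is union, i.e. c₁ ++ c₂.
Clause : Set
Clause = List Lit

_≋_ : Clause → Clause → Set
c ≋ d = (∀ l → l ∈ c → l ∈ d) × (∀ l → l ∈ d → l ∈ c)

Taut : Clause → Set
Taut c = ∃[ l ] (l ∈ c × (~ l) ∈ c)

remove : Lit → Clause → Clause
remove l c = filter (λ m → ¬? (m ≟L l)) c

-- A (possibly infinite) set of clauses, given as a predicate.  Used for sets
-- built from a finite CNF formula by set operations.
ClauseSet : Set₁
ClauseSet = Clause → Set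

-- A CNF formula: a finite set of clauses (a list read as a set of clauses,
-- clause membership taken up to set equality), with no tautological clause.
CNF : Set
CNF = List Clause

IsCNF : CNF → Set
IsCNF F = All (λ c → ¬ Taut c) F

_∈F_ : Clause → CNF → Set
c ∈F F = Any (λ d → d ≋ c) F

⟦_⟧ : CNF → ClauseSet
⟦ F ⟧ c = c ∈F F

data ResCn (S : ClauseSet) : Clause → Set where
  base : ∀ {c} → S c → ResCn S c
  res  : ∀ {d₁ d₂ r} (l : Lit) → ResCn S d₁ → ResCn S d₂ →
         l ∈ d₁ → (~ l) ∈ d₂ →
         r ≋ (remove l d₁ ++ remove (~ l) d₂) → ¬ Taut r → ResCn S r

Assignment : Set
Assignment = ℕ → Bool

evalLit : Assignment → Lit → Bool
evalLit σ (pos x) = σ x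
evalLit σ (neg x) = not (σ x)

SatClause : Assignment → Clause → Set
SatClause σ c = Any (λ l → evalLit σ l ≡ true) c

_⊨_ : ClauseSet → Clause → Set
S ⊨ c = ∀ (σ : Assignment) → (∀ d → S d → SatClause σ d) → SatClause σ c

Superredundant : ClauseSet → Clause → Set
Superredundant S c = S c × ((λ d → ResCn S d × ¬ (d ≋ c)) ⊨ c)

Occurs : ℕ → CNF → Set
Occurs x F = Any (λ d → pos x ∈ d ⊎ neg x ∈ d) F

splitF : CNF → Clause → Clause → ℕ → ClauseSet
splitF F c₁ c₂ x c =
  (c ∈F F × ¬ (c ≋ (c₁ ++ c₂))) ⊎ (c ≋ (c₁ ++ (pos x ∷ [])) ⊎ c ≋ (c₂ ++ (neg x ∷ [])))

addF : CNF → Clause → ClauseSet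
addF F c₁ c = c ∈F F ⊎ c ≋ c₁

{-# OPTIONS --safe #-}
-- Suppose σ₀ satisfies every clause of R = ResCn(F ∪ {c₁}) other than c₁ but falsifies c₁.
-- As x does not occur in R, setting x to false gives an assignment σ with the same
-- property that also falsifies K = c₁ ∨ x.  By induction over the resolution closure of
-- the split formula G, every clause of it other than K is satisfied by σ through a literal
-- other than ¬x, contradicting the superredundancy of K in G.  The delicate step resolves
-- K on a literal of c₁ against a clause d: the resolvent contains x, hence not ¬x, so
-- neither does d, and a second induction shows that d then contains a clause of R;
-- resolving c₁ against that clause gives a clause of R other than c₁ inside the resolvent.
module Submission where

open import Defs
open import Data.Nat using (ℕ)
import Data.Nat as ℕ
open import Data.Bool using (Bool; true; false; not)
import Data.Bool as Bool
open import Data.Bool.Properties using (not-involutive; not-¬)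
open import Data.List using (_++_; _∷_; [])
open import Data.List.Membership.Propositional using (_∈_; _∉_; find; lose)
open import Data.List.Membership.Propositional.Properties
  using (∈-++⁺ˡ; ∈-++⁺ʳ; ∈-++⁻; ∈-filter⁺; ∈-filter⁻)
open import Data.List.Membership.DecPropositional _≟L_ using (_∈?_)
open import Data.List.Relation.Binary.Subset.Propositional using (_⊆_)
open import Data.List.Relation.Binary.Subset.Propositional.Properties
  using (Any-resp-⊆; ++⁺; xs⊆xs++ys)
open import Data.List.Relation.Unary.Any using (here; any?)
import Data.List.Relation.Unary.Any as Any
open import Data.List.Relation.Unary.Any.Properties using (++⁻)
import Data.List.Relation.Unary.All as All
open import Data.Product using (_×_; ∃-syntax; _,_; proj₁; proj₂)
open import Data.Sum using (_⊎_; inj₁; inj₂; [_,_])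
open import Data.Empty using (⊥-elim)
open import Function using (_∘_; id)
open import Relation.Nullary using (¬_; ¬?; yes; no; contradiction)
open import Relation.Binary.PropositionalEquality
  using (_≡_; _≢_; refl; cong; sym; trans; subst)

var : Lit → ℕ
var (pos y) = y
var (neg y) = y

~-involutive : ∀ l → ~ (~ l) ≡ l
~-involutive (pos _) = refl
~-involutive (neg _) = refl

~-injective : ∀ {l m} → ~ l ≡ ~ m → l ≡ m
~-injective {l} {m} e = trans (sym (~-involutive l)) (trans (cong ~_ e) (~-involutive m))

~-var : ∀ l → var (~ l) ≡ var l
~-var (pos _) = refl
~-var (neg _) = refl

~-irreflexive : ∀ l → ~ l ≢ l
~-irreflexive (pos _) ()
~-irreflexive (neg _) ()

≋⇒⊆ : ∀ {c d} → c ≋ d → c ⊆ d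
≋⇒⊆ c≋d = proj₁ c≋d _

≋⇒⊇ : ∀ {c d} → c ≋ d → d ⊆ c
≋⇒⊇ c≋d = proj₂ c≋d _

≋-refl : ∀ {c} → c ≋ c
≋-refl = (λ _ → id) , (λ _ → id)

≋-trans : ∀ {c d e} → c ≋ d → d ≋ e → c ≋ e
≋-trans (f , g) (h , k) = (λ m → h m ∘ f m) , (λ m → g m ∘ k m)

Taut-mono : ∀ {c d} → c ⊆ d → Taut c → Taut d
Taut-mono c⊆d (m , m∈c , ~m∈c) = m , c⊆d m∈c , c⊆d ~m∈c

∈-remove⁺ : ∀ {l m c} → m ∈ c → m ≢ l → m ∈ remove l c
∈-remove⁺ {l} = ∈-filter⁺ (λ m → ¬? (m ≟L l))

∈-remove⁻ : ∀ {l m} c → m ∈ remove l c → m ∈ c × m ≢ l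
∈-remove⁻ {l} c = ∈-filter⁻ (λ m → ¬? (m ≟L l)) {xs = c}

remove-⊆ : ∀ {l} c → remove l c ⊆ c
remove-⊆ c = proj₁ ∘ ∈-remove⁻ c

∉⇒⊆-remove : ∀ {l c} → l ∉ c → c ⊆ remove l c
∉⇒⊆-remove l∉c m∈c = ∈-remove⁺ m∈c λ { refl → l∉c m∈c }

remove-mono : ∀ {l c d} → c ⊆ d → remove l c ⊆ remove l d
remove-mono {c = c} c⊆d m∈ with ∈-remove⁻ c m∈
... | m∈c , m≢l = ∈-remove⁺ (c⊆d m∈c) m≢l

remove-⊆-remove : ∀ {l c d} → remove l c ⊆ d → remove l c ⊆ remove l d
remove-⊆-remove {c = c} sub m∈ = ∈-remove⁺ (sub m∈) (proj₂ (∈-remove⁻ c m∈))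

remove-remove-⊆ : ∀ {k l c d} → remove l c ⊆ d → remove l (remove k c) ⊆ remove k d
remove-remove-⊆ {k} {c = c} sub m∈ with ∈-remove⁻ (remove k c) m∈
... | m∈′ , m≢l with ∈-remove⁻ c m∈′
... | m∈c , m≢k = ∈-remove⁺ (sub (∈-remove⁺ {c = c} m∈c m≢l)) m≢k

⊆-trans-remove : ∀ {l c d e} → c ⊆ d → l ∉ c → remove l d ⊆ e → c ⊆ e
⊆-trans-remove c⊆d l∉c sub m∈c = sub (remove-mono c⊆d (∉⇒⊆-remove l∉c m∈c))

resolvent : Lit → Clause → Clause → Clause
resolvent l c d = remove l c ++ remove (~ l) d

resolvent-⊆ : ∀ {l c d e} → remove l c ⊆ e → remove (~ l) d ⊆ e → resolvent l c d ⊆ e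
resolvent-⊆ {l} {c} sub₁ sub₂ = [ sub₁ , sub₂ ] ∘ ∈-++⁻ (remove l c)

resolvent-mono : ∀ {l c c′ d d′} → c ⊆ c′ → d ⊆ d′ → resolvent l c d ⊆ resolvent l c′ d′
resolvent-mono c⊆c′ d⊆d′ = ++⁺ (remove-mono c⊆c′) (remove-mono d⊆d′)

resolvent-remove-⊆ : ∀ {k l c d e} → resolvent l c d ⊆ e →
                     resolvent l (remove k c) (remove k d) ⊆ remove k e
resolvent-remove-⊆ {k} {l} {c} {d} sub =
  resolvent-⊆ {c = remove k c} {d = remove k d}
    (remove-remove-⊆ {c = c} (sub ∘ ∈-++⁺ˡ))
    (remove-remove-⊆ {c = d} (sub ∘ ∈-++⁺ʳ (remove l c)))

resolvent-swap : ∀ {l c d} → resolvent l c d ⊆ resolvent (~ l) d c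
resolvent-swap {l} {c} {d} = resolvent-⊆ {c = c} {d = d} left ∈-++⁺ˡ
  where
  left : remove l c ⊆ resolvent (~ l) d c
  left m∈ with ∈-remove⁻ c m∈
  ... | m∈c , m≢l =
    ∈-++⁺ʳ (remove (~ l) d) (∈-remove⁺ m∈c (m≢l ∘ λ m≡~~l → trans m≡~~l (~-involutive l)))

resolvent-comm : ∀ {l c d} → resolvent l c d ≋ resolvent (~ l) d c
resolvent-comm {l} {c} {d} =
  (λ _ → resolvent-swap {l} {c} {d}) ,
  (λ _ → subst (λ k → resolvent (~ l) d c ⊆ resolvent k c d) (~-involutive l)
                (resolvent-swap {~ l} {d} {c}))

resolvent-premises-⊆ : ∀ {l c d r} → r ≋ resolvent l c d →
                       remove l c ⊆ r × remove (~ l) d ⊆ r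
resolvent-premises-⊆ {l} {c} r≋ = ≋⇒⊇ r≋ ∘ ∈-++⁺ˡ , ≋⇒⊇ r≋ ∘ ∈-++⁺ʳ (remove l c)

pivot-∉-resolvent : ∀ {l c d} → ¬ Taut d → ~ l ∈ d → l ∉ resolvent l c d
pivot-∉-resolvent {l} {c} {d} nt ~l∈d l∈ with ∈-++⁻ (remove l c) l∈
... | inj₁ l∈′ = proj₂ (∈-remove⁻ c l∈′) refl
... | inj₂ l∈′ = nt (l , remove-⊆ d l∈′ , ~l∈d)

_∉vars_ : ℕ → Clause → Set
x ∉vars c = ∀ {m} → m ∈ c → var m ≢ x

snoc-nonTaut : ∀ {c l} → ¬ Taut c → var l ∉vars c → ¬ Taut (c ++ l ∷ [])
snoc-nonTaut {c} {l} nt fresh (m , m∈ , ~m∈) with ∈-++⁻ c m∈ | ∈-++⁻ c ~m∈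
... | inj₁ m∈c | inj₁ ~m∈c = nt (m , m∈c , ~m∈c)
... | inj₁ m∈c | inj₂ (here refl) = fresh m∈c (sym (~-var m))
... | inj₂ (here refl) | inj₁ ~m∈c = fresh ~m∈c (~-var m)
... | inj₂ (here refl) | inj₂ (here ~m≡m) = ~-irreflexive m ~m≡m

Subsumed : ClauseSet → Clause → Set
Subsumed S c = ∃[ e ] ResCn S e × e ⊆ c

ResCn-nonTaut : ∀ {S c} → (∀ {d} → S d → ¬ Taut d) → ResCn S c → ¬ Taut c
ResCn-nonTaut nt (base Sc) = nt Sc
ResCn-nonTaut nt (res _ _ _ _ _ _ ntc) = ntc

ResCn-∉vars : ∀ {S x c} → (∀ {d} → S d → x ∉vars d) → ResCn S c → x ∉vars c
ResCn-∉vars fresh (base Sc) = fresh Sc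
ResCn-∉vars fresh (res {d₁} {d₂} l D₁ D₂ _ _ c≋ _) m∈c
  with ∈-++⁻ (remove l d₁) (≋⇒⊆ c≋ m∈c)
... | inj₁ m∈₁ = ResCn-∉vars fresh D₁ (remove-⊆ d₁ m∈₁)
... | inj₂ m∈₂ = ResCn-∉vars fresh D₂ (remove-⊆ d₂ m∈₂)

Subsumed-resolvent : ∀ {S c d e} l → ¬ Taut e → resolvent l c d ⊆ e →
                     Subsumed S c → Subsumed S d → Subsumed S e
Subsumed-resolvent {c = c} {d} l nte sub (e₁ , R₁ , e₁⊆c) (e₂ , R₂ , e₂⊆d)
  with l ∈? e₁ | ~ l ∈? e₂
... | no l∉e₁ | _ = e₁ , R₁ , ⊆-trans-remove e₁⊆c l∉e₁ (sub ∘ ∈-++⁺ˡ)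
... | yes _ | no ~l∉e₂ = e₂ , R₂ , ⊆-trans-remove e₂⊆d ~l∉e₂ (sub ∘ ∈-++⁺ʳ (remove l c))
... | yes l∈e₁ | yes ~l∈e₂ =
  resolvent l e₁ e₂ , res l R₁ R₂ l∈e₁ ~l∈e₂ ≋-refl (nte ∘ Taut-mono e⊆) , e⊆
  where
  e⊆ : resolvent l e₁ e₂ ⊆ _
  e⊆ = sub ∘ resolvent-mono e₁⊆c e₂⊆d

evalLit-~ : ∀ σ l → evalLit σ (~ l) ≡ not (evalLit σ l)
evalLit-~ σ (pos y) = refl
evalLit-~ σ (neg y) = sym (not-involutive (σ y))

resolvent-sound : ∀ σ l {c d} → SatClause σ c → SatClause σ d →
                  SatClause σ (resolvent l c d)
resolvent-sound σ l {c} sc sd with find sc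
... | m , m∈c , m-true with m ≟L l
... | no m≢l = lose (∈-++⁺ˡ (∈-remove⁺ m∈c m≢l)) m-true
... | yes refl with find sd
...   | m′ , m′∈d , m′-true with m′ ≟L (~ m)
...   | no m′≢~m = lose (∈-++⁺ʳ (remove m c) (∈-remove⁺ m′∈d m′≢~m)) m′-true
...   | yes refl = ⊥-elim (not-¬ (sym m-true) (trans (sym m′-true) (evalLit-~ σ m)))

_[_≔_] : Assignment → ℕ → Bool → Assignment
(σ [ x ≔ b ]) y with y ℕ.≟ x
... | yes _ = b
... | no _ = σ y

update-≡ : ∀ σ x b → (σ [ x ≔ b ]) x ≡ b
update-≡ σ x b with x ℕ.≟ x
... | yes _ = refl
... | no x≢x = contradiction refl x≢x

evalLit-update : ∀ σ {x} b m → var m ≢ x → evalLit (σ [ x ≔ b ]) m ≡ evalLit σ m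
evalLit-update σ {x} b (pos y) y≢x with y ℕ.≟ x
... | yes y≡x = contradiction y≡x y≢x
... | no _ = refl
evalLit-update σ {x} b (neg y) y≢x with y ℕ.≟ x
... | yes y≡x = contradiction y≡x y≢x
... | no _ = refl

SatClause-update⁺ : ∀ σ {x} b {c} → x ∉vars c →
                    SatClause σ c → SatClause (σ [ x ≔ b ]) c
SatClause-update⁺ σ b fresh sc with find sc
... | m , m∈c , m-true = lose m∈c (trans (evalLit-update σ b m (fresh m∈c)) m-true)

SatClause-update⁻ : ∀ σ {x} b {c} → x ∉vars c →
                    SatClause (σ [ x ≔ b ]) c → SatClause σ c
SatClause-update⁻ σ b fresh sc with find sc
... | m , m∈c , m-true = lose m∈c (trans (sym (evalLit-update σ b m (fresh m∈c))) m-true)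

∈⇒Occurs : ∀ {m c} → m ∈ c → pos (var m) ∈ c ⊎ neg (var m) ∈ c
∈⇒Occurs {pos _} m∈c = inj₁ m∈c
∈⇒Occurs {neg _} m∈c = inj₂ m∈c

module Splitting (F : CNF) (c₁ c₂ : Clause) (x : ℕ)
  (F-nonTaut : IsCNF F) (c₁-nonTaut : ¬ Taut c₁) (c₂-nonTaut : ¬ Taut c₂)
  (c₁c₂∈F : (c₁ ++ c₂) ∈F F) (c₁∉F : ¬ (c₁ ∈F F)) (x∉F : ¬ Occurs x F) where

  K : Clause
  K = c₁ ++ pos x ∷ []

  G : ClauseSet
  G = splitF F c₁ c₂ x

  F∪c₁ : ClauseSet
  F∪c₁ = addF F c₁

  R : Clause → Set
  R = ResCn F∪c₁

  ∈F-∉vars : ∀ {d} → d ∈F F → x ∉vars d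
  ∈F-∉vars d∈F m∈d var≡x =
    x∉F (Any.map (λ e≋d → subst (λ y → pos y ∈ _ ⊎ neg y ∈ _) var≡x
                                  (∈⇒Occurs (≋⇒⊇ e≋d m∈d)))
                 d∈F)

  c₁-∉vars : x ∉vars c₁
  c₁-∉vars = ∈F-∉vars c₁c₂∈F ∘ ∈-++⁺ˡ

  c₂-∉vars : x ∉vars c₂
  c₂-∉vars = ∈F-∉vars c₁c₂∈F ∘ ∈-++⁺ʳ c₁

  ∈F-≉c₁ : ∀ {d} → d ∈F F → ¬ d ≋ c₁
  ∈F-≉c₁ d∈F d≋c₁ = c₁∉F (Any.map (λ e≋d → ≋-trans e≋d d≋c₁) d∈F)

  ∈F-nonTaut : ∀ {d} → d ∈F F → ¬ Taut d
  ∈F-nonTaut = All.lookupWith (λ nt e≋d → nt ∘ Taut-mono (≋⇒⊇ e≋d)) F-nonTaut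

  R-∉vars : ∀ {d} → R d → x ∉vars d
  R-∉vars = ResCn-∉vars [ ∈F-∉vars , (λ d≋c₁ → c₁-∉vars ∘ ≋⇒⊆ d≋c₁) ]

  G-nonTaut : ∀ {d} → ResCn G d → ¬ Taut d
  G-nonTaut =
    ResCn-nonTaut [ ∈F-nonTaut ∘ proj₁
                  , [ K-like c₁-nonTaut c₁-∉vars , K-like c₂-nonTaut c₂-∉vars ] ]
    where
    K-like : ∀ {c d l} → ¬ Taut c → var l ∉vars c → d ≋ (c ++ l ∷ []) → ¬ Taut d
    K-like nt fresh d≋ = snoc-nonTaut nt fresh ∘ Taut-mono (≋⇒⊆ d≋)

  neg-x∉K : neg x ∉ K
  neg-x∉K nx∈K with ∈-++⁻ c₁ nx∈K
  ... | inj₁ nx∈c₁ = c₁-∉vars nx∈c₁ refl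
  ... | inj₂ (here ())

  premise-∌-neg-x : ∀ {d k r} → remove k d ⊆ r → neg x ∉ r → neg x ≢ k → neg x ∉ d
  premise-∌-neg-x sub nx∉r nx≢k nx∈d = nx∉r (sub (∈-remove⁺ nx∈d nx≢k))

  Subsumed-remove-pos-x : ∀ {d r} → Subsumed F∪c₁ d → remove (pos x) d ⊆ r →
                          Subsumed F∪c₁ r
  Subsumed-remove-pos-x (e , Re , e⊆d) sub =
    e , Re , ⊆-trans-remove e⊆d (λ px∈e → R-∉vars Re px∈e refl) sub

  ∌neg-x⇒Subsumed : ∀ {d} → ResCn G d → neg x ∉ d → Subsumed F∪c₁ d
  ∌neg-x⇒Subsumed (base (inj₁ (d∈F , _))) _ = _ , base (inj₁ d∈F) , id
  ∌neg-x⇒Subsumed (base (inj₂ (inj₁ d≋K))) _ =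
    c₁ , base (inj₂ ≋-refl) , ≋⇒⊇ d≋K ∘ xs⊆xs++ys c₁ (pos x ∷ [])
  ∌neg-x⇒Subsumed (base (inj₂ (inj₂ d≋))) nx∉d =
    ⊥-elim (nx∉d (≋⇒⊇ d≋ (∈-++⁺ʳ c₂ (here refl))))
  ∌neg-x⇒Subsumed (res {d₁} {d₂} l D₁ D₂ _ _ r≋ ntr) nx∉r
    with l ≟L pos x | l ≟L neg x | resolvent-premises-⊆ {l} {d₁} {d₂} r≋
  ... | yes refl | _ | sub₁ , _ =
    Subsumed-remove-pos-x (∌neg-x⇒Subsumed D₁ (premise-∌-neg-x {d₁} sub₁ nx∉r λ ())) sub₁
  ... | no _ | yes refl | _ , sub₂ =
    Subsumed-remove-pos-x (∌neg-x⇒Subsumed D₂ (premise-∌-neg-x {d₂} sub₂ nx∉r λ ())) sub₂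
  ... | no l≢px | no l≢nx | sub₁ , sub₂ =
    Subsumed-resolvent l ntr (≋⇒⊇ r≋)
      (∌neg-x⇒Subsumed D₁ (premise-∌-neg-x {d₁} sub₁ nx∉r (l≢nx ∘ sym)))
      (∌neg-x⇒Subsumed D₂ (premise-∌-neg-x {d₂} sub₂ nx∉r (l≢px ∘ ~-injective ∘ sym)))

  module Countermodel (σ : Assignment) (σ-sat : ∀ d → R d → ¬ d ≋ c₁ → SatClause σ d)
                      (c₁-false : ¬ SatClause σ c₁) where

    Subsumed⇒Sat : ∀ {k r} → Subsumed F∪c₁ r → k ∈ c₁ → k ∉ r → SatClause σ r
    Subsumed⇒Sat (e , Re , e⊆r) k∈c₁ k∉r =
      Any-resp-⊆ e⊆r (σ-sat e Re λ e≋c₁ → k∉r (e⊆r (≋⇒⊇ e≋c₁ k∈c₁)))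

    sat-premise-with-neg-x : ∀ {d r} → SatClause σ (remove (neg x) d) ⊎ d ≋ K → neg x ∈ d →
                             remove (neg x) d ⊆ r → SatClause σ (remove (neg x) r)
    sat-premise-with-neg-x {d} (inj₁ sat) _ sub =
      Any-resp-⊆ (remove-⊆-remove {c = d} sub) sat
    sat-premise-with-neg-x (inj₂ d≋K) nx∈d _ = ⊥-elim (neg-x∉K (≋⇒⊆ d≋K nx∈d))

    sat-resolvent-with-K : ∀ {d′ d r} k → k ≢ pos x → d′ ≋ K → k ∈ d′ → ~ k ∈ d →
                           ResCn G d → r ≋ resolvent k d′ d → ¬ Taut r →
                           SatClause σ (remove (neg x) r)
    sat-resolvent-with-K {d′} {d} {r} k k≢px d′≋K k∈d′ ~k∈d D r≋ ntr =
      Any-resp-⊆ (∉⇒⊆-remove nx∉r) (Subsumed⇒Sat subsumed-r k∈c₁ k∉r)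
      where
      sub₁ : remove k d′ ⊆ r
      sub₁ = proj₁ (resolvent-premises-⊆ {k} {d′} {d} r≋)
      sub₂ : remove (~ k) d ⊆ r
      sub₂ = proj₂ (resolvent-premises-⊆ {k} {d′} {d} r≋)
      c₁⊆d′ : c₁ ⊆ d′
      c₁⊆d′ = ≋⇒⊇ d′≋K ∘ xs⊆xs++ys c₁ (pos x ∷ [])
      k∈c₁ : k ∈ c₁
      k∈c₁ with ∈-++⁻ c₁ (≋⇒⊆ d′≋K k∈d′)
      ... | inj₁ k∈ = k∈
      ... | inj₂ (here k≡px) = contradiction k≡px k≢px
      k∉r : k ∉ r
      k∉r = pivot-∉-resolvent {c = d′} (G-nonTaut D) ~k∈d ∘ ≋⇒⊆ r≋
      px∈r : pos x ∈ r
      px∈r = sub₁ (∈-remove⁺ (≋⇒⊇ d′≋K (∈-++⁺ʳ c₁ (here refl))) (k≢px ∘ sym))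
      nx∉r : neg x ∉ r
      nx∉r nx∈r = ntr (pos x , px∈r , nx∈r)
      subsumed-r : Subsumed F∪c₁ r
      subsumed-r =
        Subsumed-resolvent k ntr (≋⇒⊇ r≋ ∘ resolvent-mono {d = d} c₁⊆d′ id)
          (c₁ , base (inj₂ ≋-refl) , id)
          (∌neg-x⇒Subsumed D (premise-∌-neg-x {d} sub₂ nx∉r (k≢px ∘ ~-injective ∘ sym)))

    sat-remove-neg-x⊎≋K : ∀ {d} → ResCn G d → SatClause σ (remove (neg x) d) ⊎ d ≋ K
    sat-remove-neg-x⊎≋K (base (inj₁ (d∈F , _))) =
      inj₁ (Any-resp-⊆ (∉⇒⊆-remove λ nx∈d → ∈F-∉vars d∈F nx∈d refl)
                       (σ-sat _ (base (inj₁ d∈F)) (∈F-≉c₁ d∈F)))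
    sat-remove-neg-x⊎≋K (base (inj₂ (inj₁ d≋K))) = inj₂ d≋K
    sat-remove-neg-x⊎≋K {d} (base (inj₂ (inj₂ d≋)))
      with ++⁻ c₁ (σ-sat _ (base (inj₁ c₁c₂∈F)) (∈F-≉c₁ c₁c₂∈F))
    ... | inj₁ c₁-sat = ⊥-elim (c₁-false c₁-sat)
    ... | inj₂ c₂-sat = inj₁ (Any-resp-⊆ c₂⊆ c₂-sat)
      where
      c₂⊆ : c₂ ⊆ remove (neg x) d
      c₂⊆ m∈c₂ = ∈-remove⁺ (≋⇒⊇ d≋ (∈-++⁺ˡ m∈c₂)) λ { refl → c₂-∉vars m∈c₂ refl }
    sat-remove-neg-x⊎≋K (res {d₁} {d₂} l D₁ D₂ l∈d₁ ~l∈d₂ r≋ ntr)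
      with l ≟L pos x | l ≟L neg x | resolvent-premises-⊆ {l} {d₁} {d₂} r≋
    ... | yes refl | _ | _ , sub₂ =
      inj₁ (sat-premise-with-neg-x (sat-remove-neg-x⊎≋K D₂) ~l∈d₂ sub₂)
    ... | no _ | yes refl | sub₁ , _ =
      inj₁ (sat-premise-with-neg-x (sat-remove-neg-x⊎≋K D₁) l∈d₁ sub₁)
    ... | no l≢px | no l≢nx | _ with sat-remove-neg-x⊎≋K D₁ | sat-remove-neg-x⊎≋K D₂
    ...   | inj₂ d₁≋K | _ = inj₁ (sat-resolvent-with-K l l≢px d₁≋K l∈d₁ ~l∈d₂ D₂ r≋ ntr)
    ...   | inj₁ _ | inj₂ d₂≋K =
      inj₁ (sat-resolvent-with-K (~ l) (l≢nx ∘ ~-injective) d₂≋K ~l∈d₂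
              (subst (_∈ d₁) (sym (~-involutive l)) l∈d₁) D₁
              (≋-trans r≋ (resolvent-comm {l} {d₁} {d₂})) ntr)
    ...   | inj₁ sat₁ | inj₁ sat₂ =
      inj₁ (Any-resp-⊆ (resolvent-remove-⊆ {neg x} {l} {d₁} {d₂} (≋⇒⊇ r≋))
                       (resolvent-sound σ l sat₁ sat₂))

lemma16 : (F : CNF) (c₁ c₂ : Clause) (x : ℕ) →
    IsCNF F → ¬ Taut c₁ → ¬ Taut c₂ →
    (c₁ ++ c₂) ∈F F → ¬ (c₁ ∈F F) → ¬ Occurs x F →
    Superredundant (splitF F c₁ c₂ x) (c₁ ++ (pos x ∷ [])) →
    Superredundant (addF F c₁) c₁
lemma16 F c₁ c₂ x F-nonTaut c₁-nonTaut c₂-nonTaut c₁c₂∈F c₁∉F x∉F (_ , K-entailed) =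
  inj₂ ≋-refl , c₁-entailed
  where
  open Splitting F c₁ c₂ x F-nonTaut c₁-nonTaut c₂-nonTaut c₁c₂∈F c₁∉F x∉F

  c₁-entailed : (λ d → R d × ¬ d ≋ c₁) ⊨ c₁
  c₁-entailed σ₀ σ₀-sat with any? (λ m → evalLit σ₀ m Bool.≟ true) c₁
  ... | yes c₁-sat = c₁-sat
  ... | no c₁-false₀ = ⊥-elim (K-false (K-entailed σ σ-sat-G))
    where
    σ : Assignment
    σ = σ₀ [ x ≔ false ]

    σ-sat-R : ∀ d → R d → ¬ d ≋ c₁ → SatClause σ d
    σ-sat-R d Rd d≉c₁ = SatClause-update⁺ σ₀ false (R-∉vars Rd) (σ₀-sat d (Rd , d≉c₁))

    c₁-false : ¬ SatClause σ c₁
    c₁-false = c₁-false₀ ∘ SatClause-update⁻ σ₀ false c₁-∉vars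

    open Countermodel σ σ-sat-R c₁-false

    σ-sat-G : ∀ d → ResCn G d × ¬ d ≋ K → SatClause σ d
    σ-sat-G d (Gd , d≉K) with sat-remove-neg-x⊎≋K Gd
    ... | inj₁ sat = Any-resp-⊆ (remove-⊆ d) sat
    ... | inj₂ d≋K = ⊥-elim (d≉K d≋K)

    K-false : ¬ SatClause σ K
    K-false K-sat with ++⁻ c₁ K-sat
    ... | inj₁ c₁-sat = c₁-false c₁-sat
    ... | inj₂ (here x-true) = contradiction (trans (sym (update-≡ σ₀ x false)) x-true) λ ()
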